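{- Let $(V,\mathcal{R},k)$ be a yes-instance of \textsc{$k$-dense RTI} and let $\mathcal{C}=(C_1,\dots,C_l)$ be a conflict packing of $(V,\mathcal{R})$. Then $l\le k$ and $|V(\mathcal{C})|\le 4k$.
   Context: Rooted triplets $ab|c$ on 3-subsets of $V$; $\mathcal{R}$ is dense if it contains exactly one triplet on each 3-subset of $V$. A triplet $t$ is consistent with a rooted binary tree $T$ over $V$ if the subtree of $T$ spanning $V(t)$ is homeomorphic to $t$. \textsc{$k$-dense RTI}: decide whether some rooted binary tree over $V$ is consistent with all but at most $k$ triplets of $\mathcal{R}$. A conflict is a 4-set $C\subseteq V$ such that no rooted binary tree over $C$ is consistent with all triplets of $\mathcal{R}[C]=\{t\in\mathcal{R}:V(t)\subseteq C\}$. A leaf $a$ of a conflict $\{a,b,c,d\}$ is a seed if $\{a,b,c,d\}$ remains a conflict whichever of the three rooted triplets on $\{b,c,d\}$ is used in place of the one in $\mathcal{R}$. A conflict packing is a sequence of conflicts $C_1,\dots,C_l$ such that for each $2\le i\le l$, either $|C_i\cap\bigcup_{j<i}C_j|\le 2$, or $C_i$ has exactly one leaf not in $\bigcup_{j<i}C_j$ and that leaf is a seed of $C_i$; and which is maximal, i.e. cannot be extended by appending a further conflict satisfying this condition. $V(\mathcal{C})=\bigcup_i C_i$. -}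

module Defs where

open import Data.Nat using (ℕ; _≤_)
open import Data.Fin using (Fin; _<_)
open import Data.Fin.Subset using (Subset; ∣_∣; _∈_; _∉_; ⁅_⁆; ∁; _∩_; _∪_; ⋃; ⊥)
open import Data.Vec using (lookup)
open import Data.Bool using (true; false)
open import Data.List using (List; []; _∷_; length; _++_)
import Data.List.Membership.Propositional as LM
open import Data.List.Relation.Unary.Unique.Propositional using (Unique)
open import Data.Maybe using (Maybe; just; nothing)
open import Data.Product using (Σ; ∃; _×_; _,_)
open import Data.Sum using (_⊎_)
open import Data.Unit using (⊤)
open import Relation.Binary.PropositionalEquality using (_≡_)
open import Relation.Nullary using (¬_)

-- Ground set V = Fin n.

data Tree (n : ℕ) : Set where
  leaf : Fin n → Tree n
  node : Tree n → Tree n → Tree n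

leaves : ∀ {n} → Tree n → List (Fin n)
leaves (leaf x)   = x ∷ []
leaves (node l r) = leaves l ++ leaves r

TreeOver : ∀ {n} → Subset n → Tree n → Set
TreeOver {n} S T =
  Unique (leaves T) × ((x : Fin n) → (x ∈ S → x LM.∈ leaves T) × (x LM.∈ leaves T → x ∈ S))

restrict : ∀ {n} → Subset n → Tree n → Maybe (Tree n)
restrict S (leaf x) with lookup S x
... | true  = just (leaf x)
... | false = nothing
restrict S (node l r) with restrict S l | restrict S r
... | just tl  | just tr  = just (node tl tr)
... | just tl  | nothing  = just tl
... | nothing  | just tr  = just tr
... | nothing  | nothing  = nothing

-- A rooted triplet ab|c is represented by the triple (a , b , c).
Triplet : ℕ → Set
Triplet n = Fin n × Fin n × Fin n

-- ab|c is consistent with T : the subtree of T spanning {a,b,c} is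
-- homeomorphic to ab|c (the four child orders of the tree ab|c).
Consistent : ∀ {n} → Tree n → Triplet n → Set
Consistent T (a , b , c) =
  let S = ⁅ a ⁆ ∪ (⁅ b ⁆ ∪ ⁅ c ⁆)
      r = restrict S T
  in  r ≡ just (node (node (leaf a) (leaf b)) (leaf c))
    ⊎ r ≡ just (node (node (leaf b) (leaf a)) (leaf c))
    ⊎ r ≡ just (node (leaf c) (node (leaf a) (leaf b)))
    ⊎ r ≡ just (node (leaf c) (node (leaf b) (leaf a)))

-- A dense set of rooted triplets on V: for each 3-subset {x,y,z} of V with
-- x < y < z, exactly one triplet, determined by the value R x y z : Fin 3
-- (values of R on non-increasing triples are irrelevant).
Dense : ℕ → Set
Dense n = Fin n → Fin n → Fin n → Fin 3

tripletOf : ∀ {n} → Fin 3 → Fin n → Fin n → Fin n → Triplet n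
tripletOf Fin.zero                     x y z = (y , z , x)
tripletOf (Fin.suc Fin.zero)           x y z = (x , z , y)
tripletOf (Fin.suc (Fin.suc Fin.zero)) x y z = (x , y , z)

trip : ∀ {n} → Dense n → Fin n → Fin n → Fin n → Triplet n
trip R x y z = tripletOf (R x y z) x y z

YesInstance : ∀ {n} → Dense n → ℕ → Set
YesInstance {n} R k =
  Σ (Tree n) λ T → TreeOver (Data.Fin.Subset.⊤) T ×
  Σ (List (Fin n × Fin n × Fin n)) λ K → length K ≤ k ×
    ((x y z : Fin n) → x < y → y < z → ¬ ((x , y , z) LM.∈ K) → Consistent T (trip R x y z))

Conflict : ∀ {n} → Dense n → Subset n → Set
Conflict {n} R C =
  ∣ C ∣ ≡ 4 ×
  ¬ (Σ (Tree n) λ T → TreeOver C T ×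
       ((x y z : Fin n) → x < y → y < z → x ∈ C → y ∈ C → z ∈ C → Consistent T (trip R x y z)))

-- a is a seed of C : a ∈ C and C remains a conflict for every dense R'
-- that agrees with R on all 3-subsets except the one C ∖ {a}
-- (i.e. whichever triplet is used on C ∖ {a}).
Seed : ∀ {n} → Dense n → Subset n → Fin n → Set
Seed {n} R C a =
  a ∈ C ×
  ((R' : Dense n) →
    ((x y z : Fin n) → x < y → y < z →
       ¬ (x ∈ C × y ∈ C × z ∈ C × ¬ (a ≡ x ⊎ a ≡ y ⊎ a ≡ z)) →
       R' x y z ≡ R x y z) →
    Conflict R' C)

Extends : ∀ {n} → Dense n → Subset n → Subset n → Set
Extends {n} R U C =
  ∣ C ∩ U ∣ ≤ 2 ⊎
  (∣ C ∩ ∁ U ∣ ≡ 1 × ((x : Fin n) → x ∈ C → x ∉ U → Seed R C x))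

ValidFrom : ∀ {n} → Dense n → Subset n → List (Subset n) → Set
ValidFrom R U []       = ⊤
ValidFrom R U (C ∷ Cs) = Conflict R C × Extends R U C × ValidFrom R (U ∪ C) Cs

ConflictPacking : ∀ {n} → Dense n → List (Subset n) → Set
ConflictPacking {n} R Cs =
  ValidFrom R ⊥ Cs ×
  ((C : Subset n) → Conflict R C → ¬ Extends R (⋃ Cs) C)

-- Fix a tree T over V and a list K of at most k triplets outside which T agrees with R.
-- Each conflict C of the packing contains a triplet of K that is not contained in the
-- union U of the earlier conflicts: otherwise the restriction of T to C resolves C,
-- directly when |C ∩ U| ≤ 2 (every triplet on C then has a vertex outside U), and
-- otherwise after replacing the triplet on C minus its seed by the one T displays there,
-- against the seed property. These triplets are pairwise distinct, since each lies inside
-- its own conflict but not inside any earlier one; hence l ≤ |K| ≤ k, and |V(𝒞)| ≤ 4l.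
module Submission where

open import Defs
open import Data.Bool using (true; false)
open import Data.Nat as ℕ using (ℕ; suc; _+_; _*_; _≤_; z≤n; s≤s)
import Data.Nat.Properties as ℕ
open import Data.Fin as Fin using (Fin; _<_; _<?_; _≟_)
open import Data.Fin.Properties using (<⇒≢; <-trans)
open import Data.Fin.Subset using (Subset; inside; outside; ∣_∣; ⋃; _∈_; _∉_; _⊆_; _⊂_; ⁅_⁆; _∪_; _∩_; ∁; ⊤; Nonempty)
open import Data.Fin.Subset.Properties
  using ( _∈?_; _⊆?_; x∈p∪q⁺; x∈p∪q⁻; x∈p∩q⁺; x∈p∩q⁻; x∈∁p⇒x∉p; x∈⁅x⁆; x∈⁅y⁆⇒x≡y; ∈⊤
        ; p⊆p∪q; q⊆p∪q; ⊆-trans; p⊂q⇒∣p∣<∣q∣; p⊆q⇒∣p∣≤∣q∣; ∣⁅x⁆∣≡1; ∣⊥∣≡0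
        ; nonempty?; Empty-unique; ∪-comm; ∪-assoc)
open import Data.Vec using ([]; _∷_; lookup)
open import Data.Vec.Properties using (lookup⇒[]=; []=⇒lookup)
open import Data.List using (List; []; _∷_; length; _++_; filter)
open import Data.List.Properties using (length-removeAt′; ++-identityʳ; filter-++; length-++)
open import Data.List.Relation.Unary.All as All using (All; []; _∷_)
open import Data.List.Relation.Unary.Any using (Any; here; there; any?; _─_)
open import Data.List.Relation.Unary.AllPairs using ([]; _∷_)
open import Data.List.Relation.Unary.Unique.Propositional using (Unique)
import Data.List.Relation.Unary.Unique.Propositional.Properties as Unique
open import Data.List.Membership.Propositional using (find; lose) renaming (_∈_ to _∈ₗ_)
open import Data.List.Membership.Propositional.Properties using (∈-filter⁺; ∈-filter⁻)
open import Data.List.Relation.Binary.Subset.Propositional using () renaming (_⊆_ to _⊆ₗ_)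
open import Data.Maybe using (Maybe; just; nothing; _>>=_; maybe′)
open import Data.Product using (Σ; ∃; ∃₂; _×_; _,_; proj₁; proj₂)
open import Data.Sum using (_⊎_; inj₁; inj₂; [_,_]′)
open import Function using (_∘_)
open import Relation.Binary.PropositionalEquality
open import Relation.Nullary using (¬_; Dec; yes; no; contradiction)
open import Relation.Nullary.Decidable using (_×-dec_; _⊎-dec_; ¬?)
open import Relation.Unary using (Decidable)

module _ {a} {A : Set a} where

  ∈-─⁺ : ∀ {x y : A} {ys} (x∈ys : x ∈ₗ ys) → y ∈ₗ ys → y ≢ x → y ∈ₗ (ys ─ x∈ys)
  ∈-─⁺ (here refl)  (here refl)  y≢x = contradiction refl y≢x
  ∈-─⁺ (here refl)  (there y∈ys) _   = y∈ys
  ∈-─⁺ (there x∈ys) (here refl)  _   = here refl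
  ∈-─⁺ (there x∈ys) (there y∈ys) y≢x = there (∈-─⁺ x∈ys y∈ys y≢x)

  Unique-⊆⇒length≤ : ∀ {xs ys : List A} → Unique xs → xs ⊆ₗ ys → length xs ≤ length ys
  Unique-⊆⇒length≤ {[]}     _              _  = z≤n
  Unique-⊆⇒length≤ {x ∷ xs} {ys} (x∉xs ∷ u) xs⊆ys = begin
    suc (length xs)                  ≤⟨ s≤s (Unique-⊆⇒length≤ u xs⊆ys─x) ⟩
    suc (length (ys ─ x∈ys))         ≡⟨ length-removeAt′ ys _ ⟨
    length ys                        ∎
    where
    open ℕ.≤-Reasoning
    x∈ys = xs⊆ys (here refl)
    xs⊆ys─x : xs ⊆ₗ (ys ─ x∈ys)
    xs⊆ys─x y∈xs = ∈-─⁺ x∈ys (xs⊆ys (there y∈xs)) (λ y≡x → All.lookup x∉xs y∈xs (sym y≡x))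

<⇒Unique : ∀ {n} {x y z : Fin n} → x < y → y < z → Unique (x ∷ y ∷ z ∷ [])
<⇒Unique x<y y<z = (<⇒≢ x<y ∷ <⇒≢ (<-trans x<y y<z) ∷ []) ∷ (<⇒≢ y<z ∷ []) ∷ [] ∷ []

∣p∪q∣≤∣p∣+∣q∣ : ∀ {n} (p q : Subset n) → ∣ p ∪ q ∣ ≤ ∣ p ∣ + ∣ q ∣
∣p∪q∣≤∣p∣+∣q∣ []            []            = z≤n
∣p∪q∣≤∣p∣+∣q∣ (outside ∷ p) (outside ∷ q) = ∣p∪q∣≤∣p∣+∣q∣ p q
∣p∪q∣≤∣p∣+∣q∣ (outside ∷ p) (inside  ∷ q) = subst (∣ p ∪ q ∣ ℕ.<_) (sym (ℕ.+-suc ∣ p ∣ ∣ q ∣)) (s≤s (∣p∪q∣≤∣p∣+∣q∣ p q))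
∣p∪q∣≤∣p∣+∣q∣ (inside  ∷ p) (outside ∷ q) = s≤s (∣p∪q∣≤∣p∣+∣q∣ p q)
∣p∪q∣≤∣p∣+∣q∣ (inside  ∷ p) (inside  ∷ q) = s≤s (ℕ.≤-trans (∣p∪q∣≤∣p∣+∣q∣ p q) (ℕ.+-monoʳ-≤ ∣ p ∣ (ℕ.n≤1+n ∣ q ∣)))

∣⋃ps∣≤m*length : ∀ {n m} {ps : List (Subset n)} → All (λ p → ∣ p ∣ ≤ m) ps → ∣ ⋃ ps ∣ ≤ m * length ps
∣⋃ps∣≤m*length {n} {m} []                = subst (_≤ m * 0) (sym (∣⊥∣≡0 n)) z≤n
∣⋃ps∣≤m*length {m = m} {p ∷ ps} (∣p∣≤m ∷ rest) = begin
  ∣ p ∪ ⋃ ps ∣              ≤⟨ ∣p∪q∣≤∣p∣+∣q∣ p (⋃ ps) ⟩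
  ∣ p ∣ + ∣ ⋃ ps ∣          ≤⟨ ℕ.+-mono-≤ ∣p∣≤m (∣⋃ps∣≤m*length rest) ⟩
  m + m * length ps         ≡⟨ ℕ.*-suc m (length ps) ⟨
  m * suc (length ps)       ∎
  where open ℕ.≤-Reasoning

∣p∣>0⇒Nonempty : ∀ {n} {p : Subset n} → 0 ℕ.< ∣ p ∣ → Nonempty p
∣p∣>0⇒Nonempty {n} {p} 0<∣p∣ with nonempty? p
... | yes ne = ne
... | no  ¬ne = contradiction (trans (cong ∣_∣ (Empty-unique ¬ne)) (∣⊥∣≡0 n)) (ℕ.>⇒≢ 0<∣p∣)

module _ {n : ℕ} where

  span : Triplet n → Subset n
  span (a , b , c) = ⁅ a ⁆ ∪ (⁅ b ⁆ ∪ ⁅ c ⁆)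

  ∈-span⁺ : ∀ {a b c x} → x ∈ₗ a ∷ b ∷ c ∷ [] → x ∈ span (a , b , c)
  ∈-span⁺ {a} {b} {c} (here refl)                 = x∈p∪q⁺ (inj₁ (x∈⁅x⁆ a))
  ∈-span⁺ {a} {b} {c} (there (here refl))         = x∈p∪q⁺ (inj₂ (x∈p∪q⁺ (inj₁ (x∈⁅x⁆ b))))
  ∈-span⁺ {a} {b} {c} (there (there (here refl))) = x∈p∪q⁺ (inj₂ (x∈p∪q⁺ (inj₂ (x∈⁅x⁆ c))))

  ∈-span⁻ : ∀ {a b c x} → x ∈ span (a , b , c) → x ∈ₗ a ∷ b ∷ c ∷ []
  ∈-span⁻ {a} {b} {c} x∈span with x∈p∪q⁻ ⁅ a ⁆ _ x∈span
  ... | inj₁ x∈a = here (x∈⁅y⁆⇒x≡y a x∈a)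
  ... | inj₂ x∈bc with x∈p∪q⁻ ⁅ b ⁆ ⁅ c ⁆ x∈bc
  ...   | inj₁ x∈b = there (here (x∈⁅y⁆⇒x≡y b x∈b))
  ...   | inj₂ x∈c = there (there (here (x∈⁅y⁆⇒x≡y c x∈c)))

  span-⊆ : ∀ {C a b c} → a ∈ C → b ∈ C → c ∈ C → span (a , b , c) ⊆ C
  span-⊆ a∈C b∈C c∈C x∈span with ∈-span⁻ x∈span
  ... | here refl                 = a∈C
  ... | there (here refl)         = b∈C
  ... | there (there (here refl)) = c∈C

  span-tripletOf : ∀ v (x y z : Fin n) → span (tripletOf v x y z) ≡ span (x , y , z)
  span-tripletOf Fin.zero                     x y z = trans (sym (∪-assoc ⁅ y ⁆ ⁅ z ⁆ ⁅ x ⁆)) (∪-comm (⁅ y ⁆ ∪ ⁅ z ⁆) ⁅ x ⁆)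
  span-tripletOf (Fin.suc Fin.zero)           x y z = cong (⁅ x ⁆ ∪_) (∪-comm ⁅ z ⁆ ⁅ y ⁆)
  span-tripletOf (Fin.suc (Fin.suc Fin.zero)) x y z = refl

  3≤∣span∣ : ∀ {a b c} → Unique (a ∷ b ∷ c ∷ []) → 3 ≤ ∣ span (a , b , c) ∣
  3≤∣span∣ {a} {b} {c} ((a≢b ∷ a≢c ∷ []) ∷ (b≢c ∷ []) ∷ [] ∷ []) = begin
    3                         ≡⟨ cong (2 +_) (∣⁅x⁆∣≡1 c) ⟨
    2 + ∣ ⁅ c ⁆ ∣             ≤⟨ s≤s (p⊂q⇒∣p∣<∣q∣ c⊂bc) ⟩
    1 + ∣ ⁅ b ⁆ ∪ ⁅ c ⁆ ∣     ≤⟨ p⊂q⇒∣p∣<∣q∣ bc⊂abc ⟩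
    ∣ span (a , b , c) ∣      ∎
    where
    open ℕ.≤-Reasoning
    c⊂bc : ⁅ c ⁆ ⊂ ⁅ b ⁆ ∪ ⁅ c ⁆
    c⊂bc = q⊆p∪q ⁅ b ⁆ ⁅ c ⁆ , b , x∈p∪q⁺ (inj₁ (x∈⁅x⁆ b)) , b≢c ∘ x∈⁅y⁆⇒x≡y c
    bc⊂abc : ⁅ b ⁆ ∪ ⁅ c ⁆ ⊂ span (a , b , c)
    bc⊂abc = q⊆p∪q ⁅ a ⁆ _ , a , x∈p∪q⁺ (inj₁ (x∈⁅x⁆ a)) ,
             λ a∈bc → [ a≢b ∘ x∈⁅y⁆⇒x≡y b , a≢c ∘ x∈⁅y⁆⇒x≡y c ]′ (x∈p∪q⁻ ⁅ b ⁆ ⁅ c ⁆ a∈bc)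

  graft : Maybe (Tree n) → Maybe (Tree n) → Maybe (Tree n)
  graft (just l) (just r) = just (node l r)
  graft (just l) nothing  = just l
  graft nothing  r        = r

  restrict-node : ∀ S (l r : Tree n) → restrict S (node l r) ≡ graft (restrict S l) (restrict S r)
  restrict-node S l r with restrict S l | restrict S r
  ... | just _  | just _  = refl
  ... | just _  | nothing = refl
  ... | nothing | just _  = refl
  ... | nothing | nothing = refl

  graft->>= : ∀ S (l r : Maybe (Tree n)) →
              (graft l r >>= restrict S) ≡ graft (l >>= restrict S) (r >>= restrict S)
  graft->>= S (just l) (just r) = restrict-node S l r
  graft->>= S (just l) nothing  with restrict S l
  ... | just _  = refl
  ... | nothing = refl
  graft->>= S nothing  r        = refl

  restrict-restrict : ∀ {S C} → S ⊆ C → ∀ T → (restrict C T >>= restrict S) ≡ restrict S T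
  restrict-restrict {S} {C} S⊆C (leaf x) with lookup C x in x∈?C
  ... | true  = refl
  ... | false with lookup S x in x∈?S
  ...   | false = refl
  ...   | true  = contradiction (trans (sym x∈?C) ([]=⇒lookup (S⊆C (lookup⇒[]= x S x∈?S)))) λ ()
  restrict-restrict {S} {C} S⊆C (node l r) = begin
    (restrict C (node l r) >>= restrict S)                                ≡⟨ cong (_>>= restrict S) (restrict-node C l r) ⟩
    (graft (restrict C l) (restrict C r) >>= restrict S)                  ≡⟨ graft->>= S (restrict C l) (restrict C r) ⟩
    graft (restrict C l >>= restrict S) (restrict C r >>= restrict S)     ≡⟨ cong₂ graft (restrict-restrict S⊆C l) (restrict-restrict S⊆C r) ⟩
    graft (restrict S l) (restrict S r)                                   ≡⟨ restrict-node S l r ⟨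
    restrict S (node l r)                                                 ∎
    where open ≡-Reasoning

  leaves′ : Maybe (Tree n) → List (Fin n)
  leaves′ = maybe′ leaves []

  leaves′-graft : ∀ (l r : Maybe (Tree n)) → leaves′ (graft l r) ≡ leaves′ l ++ leaves′ r
  leaves′-graft (just l) (just r) = refl
  leaves′-graft (just l) nothing  = sym (++-identityʳ (leaves l))
  leaves′-graft nothing  r        = refl

  leaves′-restrict : ∀ C T → leaves′ (restrict C T) ≡ filter (_∈? C) (leaves T)
  leaves′-restrict C (leaf x) with lookup C x in x∈?C | x ∈? C
  ... | true  | yes _   = refl
  ... | true  | no x∉C  = contradiction (lookup⇒[]= x C x∈?C) x∉C
  ... | false | yes x∈C = contradiction (trans (sym x∈?C) ([]=⇒lookup x∈C)) λ ()
  ... | false | no _    = refl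
  leaves′-restrict C (node l r) = begin
    leaves′ (restrict C (node l r))                               ≡⟨ cong leaves′ (restrict-node C l r) ⟩
    leaves′ (graft (restrict C l) (restrict C r))                 ≡⟨ leaves′-graft (restrict C l) (restrict C r) ⟩
    leaves′ (restrict C l) ++ leaves′ (restrict C r)              ≡⟨ cong₂ _++_ (leaves′-restrict C l) (leaves′-restrict C r) ⟩
    filter (_∈? C) (leaves l) ++ filter (_∈? C) (leaves r)        ≡⟨ filter-++ (_∈? C) (leaves l) (leaves r) ⟨
    filter (_∈? C) (leaves (node l r))                            ∎
    where open ≡-Reasoning

  ∈-restrict⁺ : ∀ {C D} T → TreeOver D T → C ⊆ D → ∀ {x} → x ∈ C → x ∈ₗ leaves′ (restrict C T)
  ∈-restrict⁺ {C} T (_ , leaf⇔) C⊆D {x} x∈C =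
    subst (x ∈ₗ_) (sym (leaves′-restrict C T)) (∈-filter⁺ (_∈? C) (proj₁ (leaf⇔ x) (C⊆D x∈C)) x∈C)

  ∈-restrict⁻ : ∀ C T {x} → x ∈ₗ leaves′ (restrict C T) → x ∈ C
  ∈-restrict⁻ C T {x} x∈T∣C =
    proj₂ (∈-filter⁻ (_∈? C) {xs = leaves T} (subst (x ∈ₗ_) (leaves′-restrict C T) x∈T∣C))

  Unique-restrict : ∀ C T → Unique (leaves T) → Unique (leaves′ (restrict C T))
  Unique-restrict C T unique =
    subst Unique (sym (leaves′-restrict C T)) (Unique.filter⁺ (_∈? C) {leaves T} unique)

  restrict-treeOver : ∀ {C D} T → TreeOver D T → C ⊆ D → Nonempty C →
                      ∃ λ T' → restrict C T ≡ just T' × TreeOver C T'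
  restrict-treeOver {C} T over C⊆D (x , x∈C)
    with restrict C T | (λ {y} → ∈-restrict⁺ T over C⊆D {y}) | (λ {y} → ∈-restrict⁻ C T {y})
       | Unique-restrict C T (proj₁ over)
  ... | nothing | kept | _    | _      = contradiction (kept x∈C) λ ()
  ... | just T' | kept | only | unique = T' , refl , unique , λ y → kept , only

  -- Consistent T t unfolds to Displays (restrict (span t) T) t.
  Displays : Maybe (Tree n) → Triplet n → Set
  Displays m (a , b , c) =
      m ≡ just (node (node (leaf a) (leaf b)) (leaf c))
    ⊎ m ≡ just (node (node (leaf b) (leaf a)) (leaf c))
    ⊎ m ≡ just (node (leaf c) (node (leaf a) (leaf b)))
    ⊎ m ≡ just (node (leaf c) (node (leaf b) (leaf a)))

  consistent-restrict : ∀ {C} T {T'} → restrict C T ≡ just T' →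
                        ∀ t → span t ⊆ C → Consistent T t → Consistent T' t
  consistent-restrict {C} T {T'} T∣C≡T' t t⊆C = subst (λ m → Displays m t) T∣t≡T'∣t
    where
    T∣t≡T'∣t : restrict (span t) T ≡ restrict (span t) T'
    T∣t≡T'∣t = trans (sym (restrict-restrict t⊆C T)) (cong (_>>= restrict (span t)) T∣C≡T')

  internalNodes : Tree n → ℕ
  internalNodes (leaf _)   = 0
  internalNodes (node l r) = suc (internalNodes l + internalNodes r)

  length-leaves : ∀ t → length (leaves t) ≡ suc (internalNodes t)
  length-leaves (leaf _)   = refl
  length-leaves (node l r) = begin
    length (leaves l ++ leaves r)                   ≡⟨ length-++ (leaves l) ⟩
    length (leaves l) + length (leaves r)           ≡⟨ cong₂ _+_ (length-leaves l) (length-leaves r) ⟩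
    suc (internalNodes l) + suc (internalNodes r)   ≡⟨ cong suc (ℕ.+-suc (internalNodes l) (internalNodes r)) ⟩
    suc (suc (internalNodes l + internalNodes r))   ∎
    where open ≡-Reasoning

  Cherry : Tree n → Fin n → Fin n → Fin n → Set
  Cherry t p q r = t ≡ node (node (leaf p) (leaf q)) (leaf r) ⊎ t ≡ node (leaf r) (node (leaf p) (leaf q))

  cherry : ∀ t → internalNodes t ≡ 2 → ∃ λ p → ∃₂ λ q r → Cherry t p q r
  cherry (node (node (leaf p) (leaf q)) (leaf r)) _ = p , q , r , inj₁ refl
  cherry (node (leaf r) (node (leaf p) (leaf q))) _ = p , q , r , inj₂ refl
  cherry (leaf _)                             ()
  cherry (node (leaf _) (leaf _))             ()
  cherry (node (leaf _) (node (leaf _) (node _ _))) ()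
  cherry (node (leaf _) (node (node _ _) _))  ()
  cherry (node (node (leaf _) (leaf _)) (node _ _)) ()
  cherry (node (node (leaf _) (node _ _)) _)  ()
  cherry (node (node (node _ _) _) _)         ()

  Cherry-leaves : ∀ {t p q r} → Cherry t p q r → Unique (leaves t) →
                  Unique (p ∷ q ∷ r ∷ []) × p ∷ q ∷ r ∷ [] ⊆ₗ leaves t
  Cherry-leaves (inj₁ refl) unique = unique , λ x∈pqr → x∈pqr
  Cherry-leaves (inj₂ refl) ((r≢p ∷ r≢q ∷ []) ∷ (p≢q ∷ []) ∷ [] ∷ []) =
    (p≢q ∷ (r≢p ∘ sym) ∷ []) ∷ ((r≢q ∘ sym) ∷ []) ∷ [] ∷ [] ,
    λ { (here refl)                 → there (here refl)
      ; (there (here refl))         → there (there (here refl))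
      ; (there (there (here refl))) → here refl }

  consistent-cherry : ∀ T {t a b c p q} → restrict (span (a , b , c)) T ≡ just t → Cherry t p q c →
                      (p , q) ≡ (a , b) ⊎ (p , q) ≡ (b , a) → Consistent T (a , b , c)
  consistent-cherry _ T∣abc≡t (inj₁ refl) (inj₁ refl) = inj₁ T∣abc≡t
  consistent-cherry _ T∣abc≡t (inj₁ refl) (inj₂ refl) = inj₂ (inj₁ T∣abc≡t)
  consistent-cherry _ T∣abc≡t (inj₂ refl) (inj₁ refl) = inj₂ (inj₂ (inj₁ T∣abc≡t))
  consistent-cherry _ T∣abc≡t (inj₂ refl) (inj₂ refl) = inj₂ (inj₂ (inj₂ T∣abc≡t))

  unordered-pair : ∀ {a b p q : Fin n} → p ∈ₗ a ∷ b ∷ [] → q ∈ₗ a ∷ b ∷ [] → p ≢ q →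
                   (p , q) ≡ (a , b) ⊎ (p , q) ≡ (b , a)
  unordered-pair (here refl)         (here refl)         p≢q = contradiction refl p≢q
  unordered-pair (here refl)         (there (here refl)) _   = inj₁ refl
  unordered-pair (there (here refl)) (here refl)         _   = inj₂ refl
  unordered-pair (there (here refl)) (there (here refl)) p≢q = contradiction refl p≢q

  outgroup : ∀ {x y z r : Fin n} → r ∈ₗ x ∷ y ∷ z ∷ [] →
             ∃ λ v → ∃₂ λ a b → tripletOf v x y z ≡ (a , b , r) ×
                                (∀ {s} → s ∈ₗ x ∷ y ∷ z ∷ [] → s ≢ r → s ∈ₗ a ∷ b ∷ [])
  outgroup {x} {y} {z} r∈xyz@(here refl)                 = Fin.zero , y , z , refl , ∈-─⁺ r∈xyz
  outgroup {x} {y} {z} r∈xyz@(there (here refl))         = Fin.suc Fin.zero , x , z , refl , ∈-─⁺ r∈xyz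
  outgroup {x} {y} {z} r∈xyz@(there (there (here refl))) = Fin.suc (Fin.suc Fin.zero) , x , y , refl , ∈-─⁺ r∈xyz

  cherry-on-three : ∀ {x y z t} → Unique (x ∷ y ∷ z ∷ []) → TreeOver (span (x , y , z)) t →
                    ∃ λ p → ∃₂ λ q r → Cherry t p q r × Unique (p ∷ q ∷ r ∷ []) × p ∷ q ∷ r ∷ [] ⊆ₗ x ∷ y ∷ z ∷ []
  cherry-on-three {t = t} xyz-unique (t-unique , leaf⇔) =
    let p , q , r , t-cherry = cherry t two-internal
        pqr-unique , pqr⊆t   = Cherry-leaves t-cherry t-unique
    in  p , q , r , t-cherry , pqr-unique , t⊆xyz ∘ pqr⊆t
    where
    t⊆xyz : leaves t ⊆ₗ _
    t⊆xyz x∈t = ∈-span⁻ (proj₂ (leaf⇔ _) x∈t)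
    xyz⊆t : _ ⊆ₗ leaves t
    xyz⊆t x∈xyz = proj₁ (leaf⇔ _) (∈-span⁺ x∈xyz)
    two-internal : internalNodes t ≡ 2
    two-internal = ℕ.suc-injective (trans (sym (length-leaves t))
      (ℕ.≤-antisym (Unique-⊆⇒length≤ t-unique t⊆xyz) (Unique-⊆⇒length≤ xyz-unique xyz⊆t)))

  cherry-triplet : ∀ T {t x y z p q r} → restrict (span (x , y , z)) T ≡ just t → Cherry t p q r →
                   Unique (p ∷ q ∷ r ∷ []) → p ∷ q ∷ r ∷ [] ⊆ₗ x ∷ y ∷ z ∷ [] →
                   ∃ λ v → Consistent T (tripletOf v x y z)
  cherry-triplet T {t} {x} {y} {z} T∣xyz≡t t-cherry ((p≢q ∷ p≢r ∷ []) ∷ (q≢r ∷ []) ∷ [] ∷ []) pqr⊆xyz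
    with outgroup (pqr⊆xyz (there (there (here refl))))
  ... | v , a , b , tripletOf≡abr , other =
    v , subst (Consistent T) (sym tripletOf≡abr) (consistent-cherry T T∣abr≡t t-cherry cherry≡ab)
    where
    T∣abr≡t : restrict (span (a , b , _)) T ≡ just t
    T∣abr≡t = trans (cong (λ S → restrict S T) (trans (cong span (sym tripletOf≡abr)) (span-tripletOf v x y z)))
                    T∣xyz≡t
    cherry≡ab = unordered-pair (other (pqr⊆xyz (here refl)) p≢r) (other (pqr⊆xyz (there (here refl))) q≢r) p≢q

  displays-triplet : ∀ {C} T {x y z} → TreeOver C T → Unique (x ∷ y ∷ z ∷ []) → x ∈ C → y ∈ C → z ∈ C →
                     ∃ λ v → Consistent T (tripletOf v x y z)
  displays-triplet T {x} over xyz-unique x∈C y∈C z∈C =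
    let t , T∣xyz≡t , t-over = restrict-treeOver T over (span-⊆ x∈C y∈C z∈C) (x , ∈-span⁺ (here refl))
        _ , _ , _ , t-cherry , pqr-unique , pqr⊆xyz = cherry-on-three xyz-unique t-over
    in  cherry-triplet T T∣xyz≡t t-cherry pqr-unique pqr⊆xyz

  small-overlap⇒span⊈ : ∀ {C U : Subset n} {x y z} → ∣ C ∩ U ∣ ≤ 2 → Unique (x ∷ y ∷ z ∷ []) →
                         span (x , y , z) ⊆ C → ¬ span (x , y , z) ⊆ U
  small-overlap⇒span⊈ {C} {U} {x} {y} {z} small xyz-unique xyz⊆C xyz⊆U =
    contradiction (ℕ.≤-trans (3≤∣span∣ xyz-unique) (ℕ.≤-trans (p⊆q⇒∣p∣≤∣q∣ xyz⊆C∩U) small)) λ { (s≤s (s≤s ())) }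
    where xyz⊆C∩U : span (x , y , z) ⊆ C ∩ U
          xyz⊆C∩U w∈xyz = x∈p∩q⁺ (xyz⊆C w∈xyz , xyz⊆U w∈xyz)

  Avoids : Subset n → Fin n → Fin n → Fin n → Fin n → Set
  Avoids C a x y z = x ∈ C × y ∈ C × z ∈ C × ¬ (a ≡ x ⊎ a ≡ y ⊎ a ≡ z)

  avoids? : ∀ C a x y z → Dec (Avoids C a x y z)
  avoids? C a x y z = (x ∈? C) ×-dec (y ∈? C) ×-dec (z ∈? C) ×-dec ¬? ((a ≟ x) ⊎-dec (a ≟ y) ⊎-dec (a ≟ z))

  adopt-triplets : ∀ {C} (R : Dense n) T → TreeOver C T → (a : Fin n) →
    Σ (Dense n) λ R' → ((x y z : Fin n) → x < y → y < z → ¬ Avoids C a x y z → R' x y z ≡ R x y z)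
                     × ((x y z : Fin n) → x < y → y < z → Avoids C a x y z → Consistent T (trip R' x y z))
  adopt-triplets {C} R T T-over a = R' , agrees , displays
    where
    OnFace : Fin n → Fin n → Fin n → Set
    OnFace x y z = x < y × y < z × Avoids C a x y z
    onFace? : ∀ x y z → Dec (OnFace x y z)
    onFace? x y z = (x <? y) ×-dec (y <? z) ×-dec avoids? C a x y z
    choose : ∀ {x y z} → Dec (OnFace x y z) → Fin 3
    choose (yes (x<y , y<z , x∈C , y∈C , z∈C , _)) = proj₁ (displays-triplet T T-over (<⇒Unique x<y y<z) x∈C y∈C z∈C)
    choose {x} {y} {z} (no _) = R x y z
    R' : Dense n
    R' x y z = choose (onFace? x y z)
    agrees : (x y z : Fin n) → x < y → y < z → ¬ Avoids C a x y z → R' x y z ≡ R x y z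
    agrees x y z _ _ ¬avoids with onFace? x y z
    ... | yes (_ , _ , avoids) = contradiction avoids ¬avoids
    ... | no _                 = refl
    displays : (x y z : Fin n) → x < y → y < z → Avoids C a x y z → Consistent T (trip R' x y z)
    displays x y z x<y y<z avoids with onFace? x y z
    ... | yes (x<y′ , y<z′ , x∈C , y∈C , z∈C , _) = proj₂ (displays-triplet T T-over (<⇒Unique x<y′ y<z′) x∈C y∈C z∈C)
    ... | no ¬onFace                              = contradiction (x<y , y<z , avoids) ¬onFace

  FreshError : Subset n → Subset n → Triplet n → Set
  FreshError C U t = span t ⊆ C × ¬ span t ⊆ U

  freshError? : ∀ C U → Decidable (FreshError C U)
  freshError? C U t = (span t ⊆? C) ×-dec ¬? (span t ⊆? U)

  module _ (R : Dense n) (T : Tree n) (T-over : TreeOver ⊤ T) (K : List (Triplet n))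
           (consistent : (x y z : Fin n) → x < y → y < z → ¬ (x , y , z) ∈ₗ K → Consistent T (trip R x y z))
           where

    consistent-off-errors : ∀ {C U T'} → restrict C T ≡ just T' → ¬ Any (FreshError C U) K →
                            ∀ {x y z} → x < y → y < z → FreshError C U (x , y , z) → Consistent T' (trip R x y z)
    consistent-off-errors T∣C≡T' none {x} {y} {z} x<y y<z fresh@(xyz⊆C , _) =
      consistent-restrict T T∣C≡T' (trip R x y z) (subst (_⊆ _) (sym (span-tripletOf (R x y z) x y z)) xyz⊆C)
        (consistent x y z x<y y<z (λ xyz∈K → none (lose xyz∈K fresh)))

    restrict-to-conflict : ∀ {C} → Conflict R C → ∃ λ T' → restrict C T ≡ just T' × TreeOver C T'
    restrict-to-conflict (∣C∣≡4 , _) =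
      restrict-treeOver T T-over (λ _ → ∈⊤) (∣p∣>0⇒Nonempty (subst (0 ℕ.<_) (sym ∣C∣≡4) (s≤s z≤n)))

    no-fresh-error⇒large-overlap : ∀ {C U} → Conflict R C → ¬ Any (FreshError C U) K → ¬ ∣ C ∩ U ∣ ≤ 2
    no-fresh-error⇒large-overlap conflict@(_ , no-tree) none small =
      let T' , T∣C≡T' , T'-over = restrict-to-conflict conflict in
      no-tree (T' , T'-over , λ x y z x<y y<z x∈C y∈C z∈C →
        let xyz⊆C = span-⊆ x∈C y∈C z∈C in
        consistent-off-errors T∣C≡T' none x<y y<z (xyz⊆C , small-overlap⇒span⊈ small (<⇒Unique x<y y<z) xyz⊆C))

    no-fresh-error⇒¬Seed : ∀ {C U a} → Conflict R C → ¬ Any (FreshError C U) K → a ∉ U → ¬ Seed R C a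
    no-fresh-error⇒¬Seed {C} {U} {a} conflict none a∉U (_ , stays-conflict)
      with restrict-to-conflict conflict
    ... | T' , T∣C≡T' , T'-over with adopt-triplets R T' T'-over a
    ...   | R′ , agrees , displays = proj₂ (stays-conflict R′ agrees) (T' , T'-over , all-consistent)
      where
      all-consistent : (x y z : Fin n) → x < y → y < z → x ∈ C → y ∈ C → z ∈ C → Consistent T' (trip R′ x y z)
      all-consistent x y z x<y y<z x∈C y∈C z∈C with avoids? C a x y z
      ... | yes avoids = displays x y z x<y y<z avoids
      ... | no ¬avoids = subst (λ v → Consistent T' (tripletOf v x y z)) (sym (agrees x y z x<y y<z ¬avoids))
                           (consistent-off-errors T∣C≡T' none x<y y<z (span-⊆ x∈C y∈C z∈C , xyz⊈U))
        where
        xyz⊈U : ¬ span (x , y , z) ⊆ U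
        xyz⊈U xyz⊆U = ¬avoids (x∈C , y∈C , z∈C , λ
          { (inj₁ refl)        → a∉U (xyz⊆U (∈-span⁺ (here refl)))
          ; (inj₂ (inj₁ refl)) → a∉U (xyz⊆U (∈-span⁺ (there (here refl))))
          ; (inj₂ (inj₂ refl)) → a∉U (xyz⊆U (∈-span⁺ (there (there (here refl))))) })

    fresh-error : ∀ {C U} → Conflict R C → Extends R U C → Any (FreshError C U) K
    fresh-error {C} {U} conflict extends with any? (freshError? C U) K
    ... | yes found = found
    ... | no none with extends
    ...   | inj₁ small                = contradiction small (no-fresh-error⇒large-overlap conflict none)
    ...   | inj₂ (∣C∖U∣≡1 , seeds)    =
      let a , a∈C∖U = ∣p∣>0⇒Nonempty (subst (0 ℕ.<_) (sym ∣C∖U∣≡1) (s≤s z≤n))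
          a∈C , a∈∁U = x∈p∩q⁻ C (∁ U) a∈C∖U
          a∉U = x∈∁p⇒x∉p a∈∁U
      in  contradiction (seeds a a∈C a∉U) (no-fresh-error⇒¬Seed conflict none a∉U)

    fresh-errors : ∀ {U Cs} → ValidFrom R U Cs →
                   ∃ λ ts → length ts ≡ length Cs × Unique ts × ts ⊆ₗ K × All (λ t → ¬ span t ⊆ U) ts
    fresh-errors {Cs = []}           _                            = [] , refl , [] , (λ ()) , []
    fresh-errors {U} {C ∷ Cs} (conflict , extends , valid)
      with find (fresh-error conflict extends) | fresh-errors valid
    ... | t , t∈K , t⊆C , t⊈U | ts , ∣ts∣≡∣Cs∣ , ts-unique , ts⊆K , ts⊈U∪C =
      t ∷ ts , cong suc ∣ts∣≡∣Cs∣ , All.map differs ts⊈U∪C ∷ ts-unique ,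
      (λ { (here refl) → t∈K ; (there t'∈ts) → ts⊆K t'∈ts }) , t⊈U ∷ All.map ⊈-weaken ts⊈U∪C
      where
      differs : ∀ {t'} → ¬ span t' ⊆ U ∪ C → t ≢ t'
      differs t'⊈U∪C refl = t'⊈U∪C (⊆-trans t⊆C (q⊆p∪q U C))
      ⊈-weaken : ∀ {t'} → ¬ span t' ⊆ U ∪ C → ¬ span t' ⊆ U
      ⊈-weaken t'⊈U∪C t'⊆U = t'⊈U∪C (⊆-trans t'⊆U (p⊆p∪q C))

    length≤errors : ∀ {U Cs} → ValidFrom R U Cs → length Cs ≤ length K
    length≤errors valid =
      let ts , ∣ts∣≡∣Cs∣ , ts-unique , ts⊆K , _ = fresh-errors valid
      in  subst (_≤ length K) ∣ts∣≡∣Cs∣ (Unique-⊆⇒length≤ ts-unique ts⊆K)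

ValidFrom⇒∣C∣≤4 : ∀ {n} {R : Dense n} {U Cs} → ValidFrom R U Cs → All (λ C → ∣ C ∣ ≤ 4) Cs
ValidFrom⇒∣C∣≤4 {Cs = []}     _                        = []
ValidFrom⇒∣C∣≤4 {Cs = _ ∷ _} ((∣C∣≡4 , _) , _ , valid) = ℕ.≤-reflexive ∣C∣≡4 ∷ ValidFrom⇒∣C∣≤4 valid

lemma7 : (n : ℕ) (R : Dense n) (k : ℕ) → YesInstance R k →
         (Cs : List (Subset n)) → ConflictPacking R Cs →
         length Cs ≤ k × ∣ ⋃ Cs ∣ ≤ 4 * k
lemma7 n R k (T , T-over , K , ∣K∣≤k , consistent) Cs (valid , _) =
  l≤k , ℕ.≤-trans (∣⋃ps∣≤m*length (ValidFrom⇒∣C∣≤4 valid)) (ℕ.*-monoʳ-≤ 4 l≤k)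
  where
  l≤k : length Cs ≤ k
  l≤k = ℕ.≤-trans (length≤errors R T T-over K consistent valid) ∣K∣≤k
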